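{- Fix an alphabet size $\sigma\ge 2$. There exist a constant $C>0$ and $w_0$ such that for every $w\ge w_0$ there is a forward selection scheme on $w$-mers with density at most $C\ln(w)/w$, and a set $U\subseteq\Sigma^w$ with $|U|/\sigma^w\le C\ln(w)/w$ such that every walk of $w$ vertices in the de Bruijn graph of order $w$ contains a vertex of $U$ (i.e., an $(O(\ln(w)/w),w)$-UHS).
   Context: $\Sigma=\{0,\dots,\sigma-1\}$. For a string $S$, $S[n,l]$ is its substring starting at position $n$ of length $l$. The de Bruijn graph of order $k$ has vertex set $\Sigma^k$ and an edge $(u,v)$ for every string of length $k+1$ with prefix $u$ and suffix $v$; a walk of $l$ vertices is a sequence of $l$ (not necessarily distinct) vertices, consecutive ones joined by an edge. A local selection scheme is a function $f:\Sigma^w\to\{0,\dots,w-1\}$; on a string $S$ it selects positions $\{i+f(S[i,w]):0\le i\le |S|-w\}$. It is a forward scheme if for any two consecutive windows $\omega_1=S[i,w]$, $\omega_2=S[i+1,w]$, $f(\omega_2)\ge f(\omega_1)-1$. Its density is the limit, as $|S|\to\infty$ with $S$ uniformly random, of the expected number of distinct selected positions divided by $|S|-w+1$. An $(\alpha,l)$-UHS on $k$-mers is a set $A\subseteq\Sigma^k$ with $|A|/\sigma^k=\alpha$ meeting every walk of $l$ vertices in the de Bruijn graph of order $k$. -}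

module Defs where

open import Data.Nat using (ℕ; zero; suc; _+_; _*_; _^_; _≤_; _<_)
open import Data.Nat.Properties using (+-mono-≤-<; ≤-refl)
open import Data.Nat.Logarithm using (⌊log₂_⌋) public
open import Data.Fin using (Fin; toℕ; fromℕ<; inject₁) renaming (zero to fz; suc to fs)
open import Data.Fin.Properties using (any?; toℕ<n; _≟_)
open import Data.Bool using (Bool; true; false; if_then_else_)
open import Data.Product using (Σ; ∃; _×_; _,_)
open import Relation.Nullary.Decidable using (⌊_⌋)
open import Relation.Binary.PropositionalEquality using (_≡_)
import Data.Nat.Properties as ℕP

Word : ℕ → ℕ → Set
Word σ n = Fin n → Fin σ

Scheme : ℕ → ℕ → Set
Scheme σ w = Word σ w → Fin w

consW : ∀ {σ n} → Fin σ → Word σ n → Word σ (suc n)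
consW a S fz = a
consW a S (fs j) = S j

sumFin : (k : ℕ) → (Fin k → ℕ) → ℕ
sumFin zero g = 0
sumFin (suc k) g = g fz + sumFin k (λ i → g (fs i))

sumWords : (σ n : ℕ) → (Word σ n → ℕ) → ℕ
sumWords σ zero g = g (λ ())
sumWords σ (suc n) g = sumFin σ (λ a → sumWords σ n (λ S → g (consW a S)))

pos : ∀ {m w} → Fin (suc m) → Fin w → Fin (m + w)
pos {m} {w} i j = fromℕ< (+-mono-≤-< (ℕP.≤-pred (toℕ<n i)) (toℕ<n j))

window : ∀ {σ m w} → Word σ (m + w) → Fin (suc m) → Word σ w
window S i j = S (pos i j)

Forward : (σ w : ℕ) → Scheme σ w → Set
Forward σ w f = (S : Word σ (suc w)) →
  toℕ (f (λ j → S (inject₁ j))) ≤ suc (toℕ (f (λ j → S (fs j))))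

selectedB : ∀ {σ m w} → Scheme σ w → Word σ (m + w) → Fin (m + w) → Bool
selectedB f S p = ⌊ any? (λ i → toℕ i + toℕ (f (window S i)) Data.Nat.≟ toℕ p) ⌋
  where import Data.Nat

numSelected : ∀ {σ m w} → Scheme σ w → Word σ (m + w) → ℕ
numSelected {m = m} {w = w} f S = sumFin (m + w) (λ p → if selectedB f S p then 1 else 0)

-- total over all strings of length m+w (= sigma^(m+w) times the expectation)
totalSelected : (σ w : ℕ) → Scheme σ w → ℕ → ℕ
totalSelected σ w f m = sumWords σ (m + w) (numSelected {σ} {m} {w} f)

-- density(f) ≤ a/b, i.e. for every ε = 1/e > 0, eventually
-- E[#selected] / (|S| - w + 1) ≤ a/b + 1/e, where |S| = m + w
-- (cross-multiplied: total·b·e ≤ σ^(m+w)·(m+1)·(a·e + b)).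
DensityAtMost : (σ w : ℕ) → Scheme σ w → (a b : ℕ) → Set
DensityAtMost σ w f a b = (e : ℕ) → 1 ≤ e → ∃ λ N → (m : ℕ) → N ≤ m →
  totalSelected σ w f m * b * e ≤ σ ^ (m + w) * suc m * (a * e + b)

card : (σ k : ℕ) → (Word σ k → Bool) → ℕ
card σ k U = sumWords σ k (λ x → if U x then 1 else 0)

Edge : (σ k : ℕ) → Word σ k → Word σ k → Set
Edge σ k u v = Σ (Word σ (suc k)) λ s →
  ((j : Fin k) → u j ≡ s (inject₁ j)) × ((j : Fin k) → v j ≡ s (fs j))

-- walk of l vertices v 0, …, v (l-1) (values beyond l-1 are irrelevant)
IsWalk : (σ k l : ℕ) → (ℕ → Word σ k) → Set
IsWalk σ k l v = (t : ℕ) → suc t < l → Edge σ k (v t) (v (suc t))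

MeetsAllWalks : (σ k l : ℕ) → (Word σ k → Bool) → Set
MeetsAllWalks σ k l U = (v : ℕ → Word σ k) → IsWalk σ k l v →
  ∃ λ t → t < l × U (v t) ≡ true

-- Fix σ ≥ 2, a large w and L = ⌊log₂ w⌋.  Let P = 1 0^e be a pattern of length d = e + 1, with d
-- maximal such that d + L·σ^d ≤ w, and let K = w - d, so that P fits at K + 1 positions of a w-mer.
-- The scheme selects the first position below K at which P occurs, or K if there is none; it is
-- forward because the first occurrence moves one step left as the window slides.  The hitting set
-- consists of the w-mers that begin with P or contain no P; a walk of w vertices meets it, since an
-- occurrence of P at position j ≤ K of the first vertex is the beginning of the j-th vertex.
-- A selected position is either the start of an occurrence of P (probability σ^(-d) ≤ (σ + 1)·L/w
-- by maximality of d) or the end of a P-free window (probability a(w)/σ^w ≤ 2^(-L) < 2/w), where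
-- a(n) counts the P-free words of length n.  As P cannot overlap itself, a(n + d) + a(n) ≤ σ·a(n + e),
-- so a decays by a factor 1 - σ^(-d) per letter, and (1 - 1/N)^N ≤ 1/2 gives a(w) ≤ 2^(-L)·σ^w.

module Submission where

open import Defs
open import Data.Nat using (ℕ; _+_; _*_; _^_; _≤_; _<_)
open import Data.Product using (∃; _×_)
open import Data.Bool using (Bool)

open import Data.Bool using (true; false; if_then_else_; _∧_; _∨_; not)
open import Data.Bool.Properties using (∨-zeroʳ)
open import Data.Empty using (⊥-elim)
open import Data.Fin using (Fin; toℕ; fromℕ<; inject₁) renaming (zero to fz; suc to fs)
open import Data.Fin.Properties using (toℕ-fromℕ<; toℕ-inject₁; toℕ<n; any?)
open import Data.Nat using (zero; suc; _∸_; z≤n; s≤s; _≤?_; _≟_; NonZero; >-nonZero; ⌊_/2⌋; ⌈_/2⌉)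
open import Data.Nat.Induction using (<-wellFounded)
open import Data.Nat.Logarithm using (⌊log₂⌋-mono-≤; ⌊log₂[2^n]⌋≡n)
open import Data.Nat.Logarithm.Core using (⌊log2⌋)
open import Data.Nat.Properties
open import Algebra.Properties.CommutativeSemigroup +-commutativeSemigroup
  using () renaming (interchange to +-interchange)
open import Algebra.Properties.CommutativeSemigroup *-commutativeSemigroup
  using () renaming (interchange to *-interchange; x∙yz≈y∙xz to *-left-comm)
open import Data.Nat.Tactic.RingSolver using (solve-∀)
open import Data.Product using (_,_)
open import Data.Sum using (_⊎_; inj₁; inj₂)
open import Induction.WellFounded using (Acc; acc)
open import Relation.Binary.PropositionalEquality
open import Relation.Nullary using (¬_; Dec; yes; no)
open import Relation.Nullary.Decidable using (⌊_⌋)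

ind : Bool → ℕ
ind b = if b then 1 else 0

sumFin-mono : ∀ k {g h : Fin k → ℕ} → (∀ i → g i ≤ h i) → sumFin k g ≤ sumFin k h
sumFin-mono zero    p = z≤n
sumFin-mono (suc k) p = +-mono-≤ (p fz) (sumFin-mono k (λ i → p (fs i)))

sumFin-cong : ∀ k {g h : Fin k → ℕ} → (∀ i → g i ≡ h i) → sumFin k g ≡ sumFin k h
sumFin-cong zero    p = refl
sumFin-cong (suc k) p = cong₂ _+_ (p fz) (sumFin-cong k (λ i → p (fs i)))

sumFin-+ : ∀ k (g h : Fin k → ℕ) → sumFin k (λ i → g i + h i) ≡ sumFin k g + sumFin k h
sumFin-+ zero    g h = refl
sumFin-+ (suc k) g h =
  trans (cong (g fz + h fz +_) (sumFin-+ k (λ i → g (fs i)) (λ i → h (fs i))))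
        (+-interchange (g fz) (h fz) _ _)

sumFin-const : ∀ k c → sumFin k (λ _ → c) ≡ k * c
sumFin-const zero    c = refl
sumFin-const (suc k) c = cong (c +_) (sumFin-const k c)

sumFin-zero : ∀ k → sumFin k (λ _ → 0) ≡ 0
sumFin-zero k = trans (sumFin-const k 0) (*-zeroʳ k)

sumFin-*ˡ : ∀ k c (g : Fin k → ℕ) → sumFin k (λ i → c * g i) ≡ c * sumFin k g
sumFin-*ˡ zero    c g = sym (*-zeroʳ c)
sumFin-*ˡ (suc k) c g = trans (cong (c * g fz +_) (sumFin-*ˡ k c (λ i → g (fs i))))
                              (sym (*-distribˡ-+ c (g fz) _))

sumWords-mono : ∀ σ n {g h : Word σ n → ℕ} → (∀ x → g x ≤ h x) → sumWords σ n g ≤ sumWords σ n h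
sumWords-mono σ zero    p = p _
sumWords-mono σ (suc n) p = sumFin-mono σ (λ a → sumWords-mono σ n (λ x → p (consW a x)))

sumWords-cong : ∀ σ n {g h : Word σ n → ℕ} → (∀ x → g x ≡ h x) → sumWords σ n g ≡ sumWords σ n h
sumWords-cong σ zero    p = p _
sumWords-cong σ (suc n) p = sumFin-cong σ (λ a → sumWords-cong σ n (λ x → p (consW a x)))

sumWords-+ : ∀ σ n (g h : Word σ n → ℕ) →
  sumWords σ n (λ x → g x + h x) ≡ sumWords σ n g + sumWords σ n h
sumWords-+ σ zero    g h = refl
sumWords-+ σ (suc n) g h = trans (sumFin-cong σ (λ a → sumWords-+ σ n _ _)) (sumFin-+ σ _ _)

sumWords-const : ∀ σ n c → sumWords σ n (λ _ → c) ≡ σ ^ n * c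
sumWords-const σ zero    c = sym (+-identityʳ c)
sumWords-const σ (suc n) c =
  trans (sumFin-cong σ (λ _ → sumWords-const σ n c))
        (trans (sumFin-const σ _) (sym (*-assoc σ (σ ^ n) c)))

sumWords-zero : ∀ σ n → sumWords σ n (λ _ → 0) ≡ 0
sumWords-zero σ n = trans (sumWords-const σ n 0) (*-zeroʳ (σ ^ n))

sumWords-exchange : ∀ σ n k (g : Word σ n → Fin k → ℕ) →
  sumWords σ n (λ x → sumFin k (g x)) ≡ sumFin k (λ p → sumWords σ n (λ x → g x p))
sumWords-exchange σ n zero    g = sumWords-zero σ n
sumWords-exchange σ n (suc k) g =
  trans (sumWords-+ σ n _ _)
        (cong (sumWords σ n (λ x → g x fz) +_) (sumWords-exchange σ n k (λ x p → g x (fs p))))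

≤?-suc : ∀ k m → ⌊ suc k ≤? suc m ⌋ ≡ ⌊ k ≤? m ⌋
≤?-suc k m with k ≤? m | suc k ≤? suc m
... | yes _   | yes _          = refl
... | no  _   | no  _          = refl
... | yes k≤m | no  1+k≰1+m    = ⊥-elim (1+k≰1+m (s≤s k≤m))
... | no  k≰m | yes (s≤s k≤m)  = ⊥-elim (k≰m k≤m)

count-≤ : ∀ m X n → sumFin n (λ p → if ⌊ toℕ p ≤? m ⌋ then X else 0) ≤ suc m * X
count-≤ m X zero = z≤n
count-≤ zero X (suc n) = ≤-reflexive (cong (X +_) (sumFin-zero n))
count-≤ (suc m) X (suc n) = +-monoʳ-≤ X (begin
  sumFin n (λ p → if ⌊ suc (toℕ p) ≤? suc m ⌋ then X else 0)
    ≡⟨ sumFin-cong n (λ p → cong (λ b → if b then X else 0) (≤?-suc (toℕ p) m)) ⟩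
  sumFin n (λ p → if ⌊ toℕ p ≤? m ⌋ then X else 0)
    ≤⟨ count-≤ m X n ⟩
  suc m * X ∎)
  where open ≤-Reasoning

inRange : ℕ → ℕ → ℕ → ℕ → ℕ
inRange K m X q = if ⌊ K ≤? q ⌋ then (if ⌊ q ∸ K ≤? m ⌋ then X else 0) else 0

count-range : ∀ K m X n → sumFin n (λ p → inRange K m X (toℕ p)) ≤ suc m * X
count-range zero    m X n       = count-≤ m X n
count-range (suc K) m X zero    = z≤n
count-range (suc K) m X (suc n) = begin
  sumFin n (λ p → inRange (suc K) m X (suc (toℕ p)))
    ≡⟨ sumFin-cong n (λ p → cong (λ b → if b then (if ⌊ toℕ p ∸ K ≤? m ⌋ then X else 0) else 0)
                                 (≤?-suc K (toℕ p))) ⟩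
  sumFin n (λ p → inRange K m X (toℕ p))
    ≤⟨ count-range K m X n ⟩
  suc m * X ∎
  where open ≤-Reasoning

-- Streams over an alphabet of size σ; a word is read as a stream padded with the letter 0.
Stream : ℕ → Set
Stream σ = ℕ → Fin σ

stream : ∀ {t n} → Word (suc t) n → Stream (suc t)
stream {n = zero}  x k       = fz
stream {n = suc n} x zero    = x fz
stream {n = suc n} x (suc k) = stream (λ j → x (fs j)) k

_◃_ : ∀ {σ} → Fin σ → Stream σ → Stream σ
(a ◃ u) zero    = a
(a ◃ u) (suc k) = u k

tail : ∀ {σ} → Stream σ → Stream σ
tail u k = u (suc k)

drop : ∀ {σ} → ℕ → Stream σ → Stream σ
drop i u k = u (i + k)

stream-lookup : ∀ {t n} (x : Word (suc t) n) (p : Fin n) → stream x (toℕ p) ≡ x p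
stream-lookup x fz     = refl
stream-lookup x (fs p) = stream-lookup (λ j → x (fs j)) p

stream-lookup< : ∀ {t n} (x : Word (suc t) n) k (k<n : k < n) → stream x k ≡ x (fromℕ< k<n)
stream-lookup< x k k<n = trans (cong (stream x) (sym (toℕ-fromℕ< k<n))) (stream-lookup x (fromℕ< k<n))

stream-consW : ∀ {t n} (a : Fin (suc t)) (x : Word (suc t) n) k → stream (consW a x) k ≡ (a ◃ stream x) k
stream-consW a x zero    = refl
stream-consW a x (suc k) = refl

stream-init : ∀ {t n} (S : Word (suc t) (suc n)) k → k < n → stream (λ j → S (inject₁ j)) k ≡ stream S k
stream-init S k k<n = begin
  stream (λ j → S (inject₁ j)) k      ≡⟨ stream-lookup< (λ j → S (inject₁ j)) k k<n ⟩
  S (inject₁ (fromℕ< k<n))            ≡⟨ stream-lookup S (inject₁ (fromℕ< k<n)) ⟨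
  stream S (toℕ (inject₁ (fromℕ< k<n)))
    ≡⟨ cong (stream S) (trans (toℕ-inject₁ (fromℕ< k<n)) (toℕ-fromℕ< k<n)) ⟩
  stream S k ∎
  where open ≡-Reasoning

window-stream : ∀ {t m w} (S : Word (suc t) (m + w)) (i : Fin (suc m)) k → k < w →
  stream (window S i) k ≡ drop (toℕ i) (stream S) k
window-stream S i k k<w = begin
  stream (window S i) k               ≡⟨ stream-lookup< (window S i) k k<w ⟩
  S (pos i (fromℕ< k<w))              ≡⟨ stream-lookup S (pos i (fromℕ< k<w)) ⟨
  stream S (toℕ (pos i (fromℕ< k<w)))
    ≡⟨ cong (stream S) (trans (toℕ-fromℕ< _) (cong (toℕ i +_) (toℕ-fromℕ< k<w))) ⟩
  stream S (toℕ i + k)                ∎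
  where open ≡-Reasoning

DependsOn : ∀ {σ} {A : Set} → ℕ → (Stream σ → A) → Set
DependsOn {σ} n H = (u v : Stream σ) → (∀ k → k < n → u k ≡ v k) → H u ≡ H v

DependsOn-weaken : ∀ {σ} {A : Set} {n n'} {H : Stream σ → A} → n ≤ n' → DependsOn n H → DependsOn n' H
DependsOn-weaken n≤n' D u v u≈v = D u v (λ k k<n → u≈v k (≤-trans k<n n≤n'))

sumWords-split : ∀ {t} n {w} (H : Stream (suc t) → ℕ) → DependsOn w H →
  sumWords (suc t) (suc n) (λ x → H (stream x))
    ≡ sumFin (suc t) (λ a → sumWords (suc t) n (λ y → H (a ◃ stream y)))
sumWords-split {t} n H D =
  sumFin-cong (suc t) (λ a → sumWords-cong (suc t) n (λ y → D _ _ (λ k _ → stream-consW a y k)))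

sumWords-window₀ : ∀ t n w (H : Stream (suc t) → ℕ) → DependsOn w H → w ≤ n →
  sumWords (suc t) n (λ x → H (stream x))
    ≡ suc t ^ (n ∸ w) * sumWords (suc t) w (λ y → H (stream y))
sumWords-window₀ t n zero H D w≤n =
  trans (sumWords-cong (suc t) n (λ x → D _ _ (λ k ()))) (sumWords-const (suc t) n _)
sumWords-window₀ t (suc n) (suc w) H D (s≤s w≤n) = begin
  sumWords σ (suc n) (λ x → H (stream x))
    ≡⟨ sumWords-split n H D ⟩
  sumFin σ (λ a → sumWords σ n (λ y → H (a ◃ stream y)))
    ≡⟨ sumFin-cong σ (λ a → sumWords-window₀ t n w (λ u → H (a ◃ u)) (D-tail a) w≤n) ⟩
  sumFin σ (λ a → σ ^ (n ∸ w) * sumWords σ w (λ y → H (a ◃ stream y)))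
    ≡⟨ sumFin-*ˡ σ (σ ^ (n ∸ w)) (λ a → sumWords σ w (λ y → H (a ◃ stream y))) ⟩
  σ ^ (n ∸ w) * sumFin σ (λ a → sumWords σ w (λ y → H (a ◃ stream y)))
    ≡⟨ cong (σ ^ (n ∸ w) *_) (sym (sumWords-split w H D)) ⟩
  σ ^ (n ∸ w) * sumWords σ (suc w) (λ y → H (stream y)) ∎
  where
  open ≡-Reasoning
  σ = suc t
  D-tail : ∀ a → DependsOn w (λ u → H (a ◃ u))
  D-tail a u v u≈v = D _ _ λ { zero _ → refl ; (suc k) (s≤s k<w) → u≈v k k<w }

sumWords-window : ∀ t n i w (H : Stream (suc t) → ℕ) → DependsOn w H → i + w ≤ n →
  sumWords (suc t) n (λ x → H (drop i (stream x)))
    ≡ suc t ^ (n ∸ w) * sumWords (suc t) w (λ y → H (stream y))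
sumWords-window t n zero w H D i+w≤n = sumWords-window₀ t n w H D i+w≤n
sumWords-window t (suc n) (suc i) w H D (s≤s i+w≤n) = begin
  sumFin σ (λ _ → sumWords σ n (λ x → H (drop i (stream x))))
    ≡⟨ sumFin-cong σ (λ _ → sumWords-window t n i w H D i+w≤n) ⟩
  sumFin σ (λ _ → σ ^ (n ∸ w) * T)
    ≡⟨ sumFin-const σ _ ⟩
  σ * (σ ^ (n ∸ w) * T)
    ≡⟨ sym (*-assoc σ (σ ^ (n ∸ w)) T) ⟩
  σ ^ suc (n ∸ w) * T
    ≡⟨ cong (λ z → σ ^ z * T) (sym (+-∸-assoc 1 (≤-trans (m≤n+m w i) i+w≤n))) ⟩
  σ ^ (suc n ∸ w) * T ∎
  where
  open ≡-Reasoning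
  σ = suc t
  T = sumWords σ w (λ y → H (stream y))

binomial-lower : ∀ m k → m ^ suc k + suc k * m ^ k ≤ suc m ^ suc k
binomial-lower m zero = ≤-reflexive (base m)
  where
  base : ∀ m → m * 1 + 1 * 1 ≡ (1 + m) * 1
  base = solve-∀
binomial-lower m (suc k) = begin
  m ^ suc (suc k) + suc (suc k) * m ^ suc k
    ≤⟨ m≤m+n _ (suc k * m ^ k) ⟩
  m ^ suc (suc k) + suc (suc k) * m ^ suc k + suc k * m ^ k
    ≡⟨ expand m k (m ^ k) ⟩
  suc m * (m ^ suc k + suc k * m ^ k)
    ≤⟨ *-monoʳ-≤ (suc m) (binomial-lower m k) ⟩
  suc m ^ suc (suc k) ∎
  where
  open ≤-Reasoning
  expand : ∀ m k p → m * (m * p) + (2 + k) * (m * p) + (1 + k) * p ≡ (1 + m) * (m * p + (1 + k) * p)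
  expand = solve-∀

-- Consequently (1 + 1/M)^(M+1) ≥ 2, cleared of denominators.
two-le-power : ∀ M → 2 * M ^ suc M ≤ suc M ^ suc M
two-le-power M = begin
  2 * M ^ suc M               ≡⟨ cong (M ^ suc M +_) (+-identityʳ (M ^ suc M)) ⟩
  M ^ suc M + M * M ^ M       ≤⟨ +-monoʳ-≤ (M ^ suc M) (*-monoˡ-≤ (M ^ M) (n≤1+n M)) ⟩
  M ^ suc M + suc M * M ^ M   ≤⟨ binomial-lower M M ⟩
  suc M ^ suc M               ∎
  where open ≤-Reasoning

2^⌊log2⌋≤n : ∀ n (rec : Acc _<_ n) → 1 ≤ n → 2 ^ ⌊log2⌋ n rec ≤ n
2^⌊log2⌋≤n (suc zero)    _          _ = s≤s z≤n
2^⌊log2⌋≤n (suc (suc n)) (acc rec) _ = begin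
  2 * 2 ^ ⌊log2⌋ (suc h) _      ≤⟨ *-monoʳ-≤ 2 (2^⌊log2⌋≤n (suc h) _ (s≤s z≤n)) ⟩
  2 * suc h                     ≡⟨ *-suc 2 h ⟩
  2 + (h + (h + 0))             ≡⟨ cong (λ x → 2 + (h + x)) (+-identityʳ h) ⟩
  2 + (h + h)                   ≤⟨ +-monoʳ-≤ 2 (+-monoʳ-≤ h (⌊n/2⌋≤⌈n/2⌉ n)) ⟩
  2 + (h + ⌈ n /2⌉)             ≡⟨ cong (2 +_) (⌊n/2⌋+⌈n/2⌉≡n n) ⟩
  2 + n                         ∎
  where
  open ≤-Reasoning
  h = ⌊ n /2⌋

2^⌊log₂⌋≤n : ∀ n → 1 ≤ n → 2 ^ ⌊log₂ n ⌋ ≤ n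
2^⌊log₂⌋≤n n = 2^⌊log2⌋≤n n (<-wellFounded n)

n<2^[1+⌊log₂⌋] : ∀ n → n < 2 * 2 ^ ⌊log₂ n ⌋
n<2^[1+⌊log₂⌋] n = ≰⇒> λ 2^[1+L]≤n →
  1+n≰n (subst (_≤ ⌊log₂ n ⌋) (⌊log₂[2^n]⌋≡n (suc ⌊log₂ n ⌋)) (⌊log₂⌋-mono-≤ 2^[1+L]≤n))

n<2^n : ∀ n → n < 2 ^ n
n<2^n zero    = s≤s z≤n
n<2^n (suc n) = begin
  suc (suc n)       ≤⟨ +-mono-≤ (m^n>0 2 n) (n<2^n n) ⟩
  2 ^ n + 2 ^ n     ≡⟨ cong (2 ^ n +_) (+-identityʳ (2 ^ n)) ⟨
  2 ^ suc n         ∎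
  where open ≤-Reasoning

σL<2^L : ∀ σ L → σ + σ * σ ≤ L → suc (L * σ) ≤ 2 ^ L
σL<2^L σ L σ+σ²≤L = begin
  suc (L * σ)                 ≡⟨ cong (λ x → suc (x * σ)) L≡ ⟨
  suc ((σ + (σ * σ + r)) * σ) ≤⟨ m≤m+n _ (r + σ) ⟩
  suc ((σ + (σ * σ + r)) * σ) + (r + σ) ≡⟨ expand σ r ⟩
  suc σ * suc (σ * σ + r)     ≤⟨ *-mono-≤ (n<2^n σ) (n<2^n (σ * σ + r)) ⟩
  2 ^ σ * 2 ^ (σ * σ + r)     ≡⟨ ^-distribˡ-+-* 2 σ (σ * σ + r) ⟨
  2 ^ (σ + (σ * σ + r))       ≡⟨ cong (2 ^_) L≡ ⟩
  2 ^ L                       ∎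
  where
  open ≤-Reasoning
  r = L ∸ (σ + σ * σ)
  L≡ : σ + (σ * σ + r) ≡ L
  L≡ = trans (sym (+-assoc σ (σ * σ) r)) (m+[n∸m]≡n σ+σ²≤L)
  expand : ∀ σ r → suc ((σ + (σ * σ + r)) * σ) + (r + σ) ≡ suc σ * suc (σ * σ + r)
  expand = solve-∀

last-true : (P : ℕ → Set) → (∀ n → Dec (P n)) → P 1 → ∀ n → ¬ P (suc n) →
  ∃ λ d → 1 ≤ d × P d × ¬ P (suc d)
last-true P P? P1 zero    ¬P1 = ⊥-elim (¬P1 P1)
last-true P P? P1 (suc n) ¬P[2+n] with P? (suc n)
... | yes P[1+n] = suc n , s≤s z≤n , P[1+n] , ¬P[2+n]
... | no ¬P[1+n] = last-true P P? P1 n ¬P[1+n]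

-- The pattern P = 1 0^e of length d = e + 1 over the alphabet {0, …, σ-1}, σ = s + 2.
-- P cannot overlap itself non-trivially, which is what makes its occurrences easy to count.
module Pattern (s e : ℕ) where

  σ : ℕ
  σ = suc (suc s)

  d : ℕ
  d = suc e

  isZero : Fin σ → Bool
  isZero fz     = true
  isZero (fs _) = false

  isOne : Fin σ → Bool
  isOne (fs fz) = true
  isOne _       = false

  zeros : Stream σ → ℕ → Bool
  zeros u zero    = true
  zeros u (suc k) = isZero (u 0) ∧ zeros (tail u) k

  occ : Stream σ → Bool
  occ u = isOne (u 0) ∧ zeros (tail u) e

  noOcc : Stream σ → ℕ → Bool
  noOcc u zero    = true
  noOcc u (suc c) = not (occ u) ∧ noOcc (tail u) c

  first : Stream σ → ℕ → ℕ
  first u zero    = 0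
  first u (suc c) = if occ u then 0 else suc (first (tail u) c)

  zeros-dep : ∀ k → DependsOn k (λ u → zeros u k)
  zeros-dep zero    u v u≈v = refl
  zeros-dep (suc k) u v u≈v =
    cong₂ _∧_ (cong isZero (u≈v 0 (s≤s z≤n)))
              (zeros-dep k (tail u) (tail v) (λ j j<k → u≈v (suc j) (s≤s j<k)))

  occ-dep : DependsOn d occ
  occ-dep u v u≈v =
    cong₂ _∧_ (cong isOne (u≈v 0 (s≤s z≤n)))
              (zeros-dep e (tail u) (tail v) (λ j j<e → u≈v (suc j) (s≤s j<e)))

  ind-occ-dep : DependsOn d (λ u → ind (occ u))
  ind-occ-dep u v u≈v = cong ind (occ-dep u v u≈v)

  noOcc-dep : ∀ c → DependsOn (c + e) (λ u → noOcc u c)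
  noOcc-dep zero    u v u≈v = refl
  noOcc-dep (suc c) u v u≈v =
    cong₂ _∧_ (cong not (occ-dep u v (λ k k<d → u≈v k (≤-trans k<d (s≤s (m≤n+m e c))))))
              (noOcc-dep c (tail u) (tail v) (λ j j< → u≈v (suc j) (s≤s j<)))

  first-dep : ∀ c → DependsOn (c + e) (λ u → first u c)
  first-dep zero    u v u≈v = refl
  first-dep (suc c) u v u≈v
    rewrite occ-dep u v (λ k k<d → u≈v k (≤-trans k<d (s≤s (m≤n+m e c))))
          | first-dep c (tail u) (tail v) (λ j j< → u≈v (suc j) (s≤s j<)) = refl

  first≤ : ∀ (u : Stream σ) c → first u c ≤ c
  first≤ u zero = z≤n
  first≤ u (suc c) with occ u
  ... | true  = z≤n
  ... | false = s≤s (first≤ (tail u) c)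

  first-mono : ∀ (u : Stream σ) c → first u c ≤ first u (suc c)
  first-mono u zero = z≤n
  first-mono u (suc c) with occ u
  ... | true  = z≤n
  ... | false = s≤s (first-mono (tail u) c)

  first-forward : ∀ (u : Stream σ) c → first u c ≤ suc (first (tail u) c)
  first-forward u zero = z≤n
  first-forward u (suc c) with occ u
  ... | true  = z≤n
  ... | false = s≤s (first-mono (tail u) c)

  noOcc-false : ∀ (u : Stream σ) c → noOcc u c ≡ false → ∃ λ j → j < c × occ (drop j u) ≡ true
  noOcc-false u zero ()
  noOcc-false u (suc c) none with occ u in o
  ... | true  = 0 , s≤s z≤n , o
  ... | false with noOcc-false (tail u) c none
  ... | j , j<c , oj = suc j , s≤s j<c , oj

  first-spec : ∀ (v : Stream σ) c →
    (first v c ≤ c × occ (drop (first v c) v) ≡ true) ⊎ (first v c ≡ c × noOcc v (suc c) ≡ true)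
  first-spec v zero with occ v
  ... | true  = inj₁ (z≤n , refl)
  ... | false = inj₂ (refl , refl)
  first-spec v (suc c) with occ v in o
  ... | true  = inj₁ (z≤n , o)
  ... | false with first-spec (tail v) c
  ... | inj₁ (f≤c , of) = inj₁ (s≤s f≤c , of)
  ... | inj₂ (f≡c , none) = inj₂ (cong suc f≡c , none)

  sum-zeros-prefix : ∀ k r (H : Stream σ → ℕ) →
    sumWords σ (k + r) (λ y → if zeros (stream y) k then H (drop k (stream y)) else 0)
      ≡ sumWords σ r (λ z → H (stream z))
  sum-zeros-prefix zero    r H = refl
  sum-zeros-prefix (suc k) r H = begin
    Z + sumFin (suc s) (λ _ → sumWords σ (k + r) (λ _ → 0))
      ≡⟨ cong (Z +_) (trans (sumFin-cong (suc s) (λ _ → sumWords-zero σ (k + r))) (sumFin-zero (suc s))) ⟩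
    Z + 0
      ≡⟨ +-identityʳ Z ⟩
    Z
      ≡⟨ sum-zeros-prefix k r H ⟩
    sumWords σ r (λ z → H (stream z)) ∎
    where
    open ≡-Reasoning
    Z = sumWords σ (k + r) (λ y → if zeros (stream y) k then H (drop k (stream y)) else 0)

  count-occ : sumWords σ d (λ y → ind (occ (stream y))) ≡ 1
  count-occ = begin
    sumWords σ e (λ _ → 0) + (O + sumFin s (λ _ → sumWords σ e (λ _ → 0)))
      ≡⟨ cong₂ (λ x y → x + (O + y)) (sumWords-zero σ e)
                (trans (sumFin-cong s (λ _ → sumWords-zero σ e)) (sumFin-zero s)) ⟩
    O + 0
      ≡⟨ +-identityʳ O ⟩
    O
      ≡⟨ cong (λ n → sumWords σ n (λ y → ind (zeros (stream y) e))) (sym (+-identityʳ e)) ⟩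
    sumWords σ (e + 0) (λ y → ind (zeros (stream y) e))
      ≡⟨ sum-zeros-prefix e 0 (λ _ → 1) ⟩
    1 ∎
    where
    open ≡-Reasoning
    O = sumWords σ e (λ y → ind (zeros (stream y) e))

  -- Words avoiding P.  avoid c n counts the words of length n with no occurrence of P at the
  -- positions 0, …, c-1, and a n = avoid (n + 1 - d) n those of length n avoiding P altogether.
  avoid : ℕ → ℕ → ℕ
  avoid c n = sumWords σ n (λ x → ind (noOcc (stream x) c))

  a : ℕ → ℕ
  a n = avoid (suc n ∸ d) n

  noOcc-after-zeros : ∀ k (u : Stream σ) c → zeros u k ≡ true → noOcc u c ≡ noOcc (drop k u) (c ∸ k)
  noOcc-after-zeros zero    u c       z = refl
  noOcc-after-zeros (suc k) u zero    z = refl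
  noOcc-after-zeros (suc k) u (suc c) z with u 0
  ... | fz = noOcc-after-zeros k (tail u) c z
  noOcc-after-zeros (suc k) u (suc c) () | fs _

  split-ind : ∀ o n → ind (not o ∧ n) + ind (o ∧ n) ≡ ind n
  split-ind true  n = refl
  split-ind false n = +-identityʳ (ind n)

  startsWithP : ℕ → ℕ → ℕ
  startsWithP c n =
    sumFin σ (λ b → sumWords σ n (λ y → ind ((isOne b ∧ zeros (stream y) e) ∧ noOcc (stream y) c)))

  avoid-first-letter : ∀ c n → avoid (suc c) (suc n) + startsWithP c n ≡ σ * avoid c n
  avoid-first-letter c n = begin
    sumFin σ (λ b → sumWords σ n (λ y → ind (not (o b y) ∧ nO y)))
      + sumFin σ (λ b → sumWords σ n (λ y → ind (o b y ∧ nO y)))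
      ≡⟨ sym (sumFin-+ σ (λ b → sumWords σ n (λ y → ind (not (o b y) ∧ nO y)))
                         (λ b → sumWords σ n (λ y → ind (o b y ∧ nO y)))) ⟩
    sumFin σ (λ b → sumWords σ n (λ y → ind (not (o b y) ∧ nO y))
                  + sumWords σ n (λ y → ind (o b y ∧ nO y)))
      ≡⟨ sumFin-cong σ (λ b → sym (sumWords-+ σ n (λ y → ind (not (o b y) ∧ nO y))
                                                      (λ y → ind (o b y ∧ nO y)))) ⟩
    sumFin σ (λ b → sumWords σ n (λ y → ind (not (o b y) ∧ nO y) + ind (o b y ∧ nO y)))
      ≡⟨ sumFin-cong σ (λ b → sumWords-cong σ n (λ y → split-ind (o b y) (nO y))) ⟩
    sumFin σ (λ _ → avoid c n)
      ≡⟨ sumFin-const σ (avoid c n) ⟩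
    σ * avoid c n ∎
    where
    open ≡-Reasoning
    o : Fin σ → Word σ n → Bool
    o b y = isOne b ∧ zeros (stream y) e
    nO : Word σ n → Bool
    nO y = noOcc (stream y) c

  -- Keeping only the letter 1 and deleting the e zeros that must follow it.
  startsWithP-≥ : ∀ c r → avoid (c ∸ e) r ≤ startsWithP c (e + r)
  startsWithP-≥ c r = begin
    avoid (c ∸ e) r
      ≡⟨ sym (sum-zeros-prefix e r (λ u → ind (noOcc u (c ∸ e)))) ⟩
    sumWords σ (e + r) (λ y → if zeros (stream y) e then ind (noOcc (drop e (stream y)) (c ∸ e)) else 0)
      ≡⟨ sumWords-cong σ (e + r) (λ y → restrict (stream y)) ⟩
    T
      ≤⟨ m≤m+n T (sumFin s (λ b → term (fs (fs b)))) ⟩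
    T + sumFin s (λ b → term (fs (fs b)))
      ≤⟨ m≤n+m _ (term fz) ⟩
    startsWithP c (e + r) ∎
    where
    open ≤-Reasoning
    term : Fin σ → ℕ
    term b = sumWords σ (e + r) (λ y → ind ((isOne b ∧ zeros (stream y) e) ∧ noOcc (stream y) c))
    T = term (fs fz)
    restrict : ∀ u → (if zeros u e then ind (noOcc (drop e u) (c ∸ e)) else 0) ≡ ind (zeros u e ∧ noOcc u c)
    restrict u with zeros u e in z
    ... | true  = cong ind (sym (noOcc-after-zeros e u c z))
    ... | false = refl

  a-recurrence : ∀ r → a (suc (e + r)) + a r ≤ σ * a (e + r)
  a-recurrence r = begin
    a (suc (e + r)) + a r
      ≡⟨ cong (λ c → avoid c (suc (e + r)) + a r) d-shift ⟩
    avoid (suc r) (suc (e + r)) + avoid (r ∸ e) r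
      ≤⟨ +-monoʳ-≤ (avoid (suc r) (suc (e + r))) (startsWithP-≥ r r) ⟩
    avoid (suc r) (suc (e + r)) + startsWithP r (e + r)
      ≡⟨ avoid-first-letter r (e + r) ⟩
    σ * avoid r (e + r)
      ≡⟨ cong (λ c → σ * avoid c (e + r)) (sym (m+n∸m≡n e r)) ⟩
    σ * a (e + r) ∎
    where
    open ≤-Reasoning
    d-shift : suc (e + r) ∸ e ≡ suc r
    d-shift = trans (cong (_∸ e) (sym (+-suc e r))) (m+n∸m≡n e (suc r))

  noOcc-tail : ∀ (u : Stream σ) c → ind (noOcc u c) ≤ ind (noOcc (tail u) (c ∸ 1))
  noOcc-tail u zero = ≤-refl
  noOcc-tail u (suc c) with occ u
  ... | true  = z≤n
  ... | false = ≤-refl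

  a-step : ∀ j → a (suc j) ≤ σ * a j
  a-step j = begin
    a (suc j)
      ≤⟨ sumFin-mono σ (λ b → sumWords-mono σ j (λ y →
           noOcc-tail (stream (consW b y)) (suc (suc j) ∸ d))) ⟩
    sumFin σ (λ _ → avoid (suc (suc j) ∸ d ∸ 1) j)
      ≡⟨ cong (λ c → sumFin σ (λ _ → avoid c j)) c-eq ⟩
    sumFin σ (λ _ → a j)
      ≡⟨ sumFin-const σ (a j) ⟩
    σ * a j ∎
    where
    open ≤-Reasoning
    c-eq : suc (suc j) ∸ d ∸ 1 ≡ suc j ∸ d
    c-eq = trans (∸-+-assoc (suc (suc j)) d 1) (cong (suc (suc j) ∸_) (+-comm d 1))

  a-steps : ∀ j t → a (j + t) ≤ σ ^ t * a j
  a-steps j zero = ≤-reflexive (trans (cong a (+-identityʳ j)) (sym (+-identityʳ (a j))))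
  a-steps j (suc t) = begin
    a (j + suc t)     ≡⟨ cong a (+-suc j t) ⟩
    a (suc (j + t))   ≤⟨ a-step (j + t) ⟩
    σ * a (j + t)     ≤⟨ *-monoʳ-≤ σ (a-steps j t) ⟩
    σ * (σ ^ t * a j) ≡⟨ *-assoc σ (σ ^ t) (a j) ⟨
    σ ^ suc t * a j   ∎
    where open ≤-Reasoning

  a-short : a e ≡ σ ^ e
  a-short = trans (cong (λ c → avoid c e) (n∸n≡0 e)) (trans (sumWords-const σ e 1) (*-identityʳ _))

  N : ℕ
  N = σ ^ d

  M : ℕ
  M = N ∸ 1

  N≡1+M : N ≡ suc M
  N≡1+M = trans (sym (m∸n+n≡m {N} {1} (m^n>0 σ d))) (+-comm M 1)

  -- Each further letter beyond e keeps at most a fraction (N-1)/N of the σ continuations: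
  -- N · a(r + d) ≤ M · σ · a(r + e).
  a-decay-step : ∀ r → N * a (suc (e + r)) ≤ M * (σ * a (e + r))
  a-decay-step r = +-cancelʳ-≤ (σ * a (e + r)) _ _ (begin
    N * a (suc (e + r)) + σ * a (e + r)
      ≤⟨ +-monoʳ-≤ (N * a (suc (e + r))) σa≤Na ⟩
    N * a (suc (e + r)) + N * a r
      ≡⟨ *-distribˡ-+ N _ _ ⟨
    N * (a (suc (e + r)) + a r)
      ≤⟨ *-monoʳ-≤ N (a-recurrence r) ⟩
    N * (σ * a (e + r))
      ≡⟨ cong (_* (σ * a (e + r))) N≡1+M ⟩
    σ * a (e + r) + M * (σ * a (e + r))
      ≡⟨ +-comm (σ * a (e + r)) _ ⟩
    M * (σ * a (e + r)) + σ * a (e + r) ∎)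
    where
    open ≤-Reasoning
    σa≤Na : σ * a (e + r) ≤ N * a r
    σa≤Na = begin
      σ * a (e + r)       ≡⟨ cong (λ n → σ * a n) (+-comm e r) ⟩
      σ * a (r + e)       ≤⟨ *-monoʳ-≤ σ (a-steps r e) ⟩
      σ * (σ ^ e * a r)   ≡⟨ *-assoc σ (σ ^ e) (a r) ⟨
      N * a r             ∎

  a-decay : ∀ t → a (e + t) * N ^ t ≤ M ^ t * σ ^ t * σ ^ e
  a-decay zero = ≤-reflexive (trans (*-identityʳ _)
                   (trans (cong a (+-identityʳ e)) (trans a-short (sym (+-identityʳ _)))))
  a-decay (suc t) = begin
    a (e + suc t) * N ^ suc t
      ≡⟨ cong (λ n → a n * N ^ suc t) (+-suc e t) ⟩
    a (suc (e + t)) * (N * N ^ t)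
      ≡⟨ reassoc₁ (a (suc (e + t))) N (N ^ t) ⟩
    (N * a (suc (e + t))) * N ^ t
      ≤⟨ *-monoˡ-≤ (N ^ t) (a-decay-step t) ⟩
    (M * (σ * a (e + t))) * N ^ t
      ≡⟨ reassoc₂ M σ (a (e + t)) (N ^ t) ⟩
    M * σ * (a (e + t) * N ^ t)
      ≤⟨ *-monoʳ-≤ (M * σ) (a-decay t) ⟩
    M * σ * (M ^ t * σ ^ t * σ ^ e)
      ≡⟨ reassoc₃ M σ (M ^ t) (σ ^ t) (σ ^ e) ⟩
    M ^ suc t * σ ^ suc t * σ ^ e ∎
    where
    open ≤-Reasoning
    reassoc₁ : ∀ x n y → x * (n * y) ≡ (n * x) * y
    reassoc₁ = solve-∀
    reassoc₂ : ∀ m σ x y → (m * (σ * x)) * y ≡ m * σ * (x * y)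
    reassoc₂ = solve-∀
    reassoc₃ : ∀ m σ x y z → m * σ * (x * y * z) ≡ (m * x) * (σ * y) * z
    reassoc₃ = solve-∀

  -- M ≥ 1 because σ ≥ 2; it is cancelled in the next bound.
  1≤M : 1 ≤ M
  1≤M = ≤-pred (subst (2 ≤_) N≡1+M (begin
    2          ≤⟨ s≤s (s≤s z≤n) ⟩
    σ          ≡⟨ *-identityʳ σ ⟨
    σ * 1      ≤⟨ *-monoʳ-≤ σ (m^n>0 σ e) ⟩
    N          ∎))
    where open ≤-Reasoning

  -- (1 - 1/N)^(L·N) ≤ 2^(-L), i.e. 2^L · M^(L·N) ≤ N^(L·N).
  power-gap : ∀ L → 2 ^ L * M ^ (L * N) ≤ N ^ (L * N)
  power-gap zero = ≤-refl
  power-gap (suc L) = begin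
    2 * 2 ^ L * M ^ (N + L * N)
      ≡⟨ cong (2 * 2 ^ L *_) (^-distribˡ-+-* M N (L * N)) ⟩
    2 * 2 ^ L * (M ^ N * M ^ (L * N))
      ≡⟨ *-interchange 2 (2 ^ L) (M ^ N) (M ^ (L * N)) ⟩
    (2 * M ^ N) * (2 ^ L * M ^ (L * N))
      ≤⟨ *-mono-≤ 2M^N≤N^N (power-gap L) ⟩
    N ^ N * N ^ (L * N)
      ≡⟨ ^-distribˡ-+-* N N (L * N) ⟨
    N ^ (N + L * N) ∎
    where
    open ≤-Reasoning
    2M^N≤N^N : 2 * M ^ N ≤ N ^ N
    2M^N≤N^N = subst (λ n → 2 * M ^ n ≤ n ^ n) (sym N≡1+M) (two-le-power M)

  a-bound : ∀ L w → e + L * N ≤ w → a w * 2 ^ L ≤ σ ^ w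
  a-bound L w e+LN≤w = begin
    a w * 2 ^ L
      ≡⟨ cong (λ n → a n * 2 ^ L) (m+[n∸m]≡n e+LN≤w) ⟨
    a (k + r) * 2 ^ L
      ≤⟨ *-monoˡ-≤ (2 ^ L) (a-steps k r) ⟩
    σ ^ r * a k * 2 ^ L
      ≡⟨ *-assoc (σ ^ r) (a k) _ ⟩
    σ ^ r * (a k * 2 ^ L)
      ≤⟨ *-monoʳ-≤ (σ ^ r) a-bound-at ⟩
    σ ^ r * σ ^ k
      ≡⟨ trans (sym (^-distribˡ-+-* σ r k)) (cong (σ ^_) (trans (+-comm r k) (m+[n∸m]≡n e+LN≤w))) ⟩
    σ ^ w ∎
    where
    open ≤-Reasoning
    k = e + L * N
    r = w ∸ k
    instance
      M^LN≢0 : NonZero (M ^ (L * N))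
      M^LN≢0 = m^n≢0 M (L * N) {{>-nonZero 1≤M}}
    a-bound-at : a k * 2 ^ L ≤ σ ^ k
    a-bound-at = *-cancelʳ-≤ (a k * 2 ^ L) (σ ^ k) (M ^ (L * N)) (begin
      a k * 2 ^ L * M ^ (L * N)
        ≡⟨ *-assoc (a k) (2 ^ L) _ ⟩
      a k * (2 ^ L * M ^ (L * N))
        ≤⟨ *-monoʳ-≤ (a k) (power-gap L) ⟩
      a k * N ^ (L * N)
        ≤⟨ a-decay (L * N) ⟩
      M ^ (L * N) * σ ^ (L * N) * σ ^ e
        ≡⟨ *-assoc (M ^ (L * N)) _ _ ⟩
      M ^ (L * N) * (σ ^ (L * N) * σ ^ e)
        ≡⟨ cong (M ^ (L * N) *_) (trans (cong (σ ^_) (+-comm e (L * N))) (^-distribˡ-+-* σ (L * N) e)) ⟨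
      M ^ (L * N) * σ ^ k
        ≡⟨ *-comm (M ^ (L * N)) (σ ^ k) ⟩
      σ ^ k * M ^ (L * N) ∎)

module Construction (s e K : ℕ) where

  open Pattern s e

  W : ℕ
  W = d + K

  -- the window W = d + K is long enough for the lookahead of `first` at position K
  K+e<W : K + e < W
  K+e<W = s≤s (≤-reflexive (+-comm K e))

  first<W : ∀ (u : Stream σ) → first u K < W
  first<W u = s≤s (≤-trans (first≤ u K) (m≤n+m K e))

  scheme : Scheme σ W
  scheme ω = fromℕ< (first<W (stream ω))

  toℕ-scheme : ∀ ω → toℕ (scheme ω) ≡ first (stream ω) K
  toℕ-scheme ω = toℕ-fromℕ< (first<W (stream ω))

  forward : Forward σ W scheme
  forward S = subst₂ _≤_ (sym (trans (toℕ-scheme ω₁) ω₁≈S)) (cong suc (sym (toℕ-scheme ω₂)))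
                         (first-forward (stream S) K)
    where
    ω₁ ω₂ : Word σ W
    ω₁ j = S (inject₁ j)
    ω₂ j = S (fs j)
    ω₁≈S : first (stream ω₁) K ≡ first (stream S) K
    ω₁≈S = first-dep K (stream ω₁) (stream S) (λ k k< → stream-init S k (<-trans k< K+e<W))

  hitting : Word σ W → Bool
  hitting ω = occ (stream ω) ∨ noOcc (stream ω) (suc K)

  ind-∨ : ∀ x y → ind (x ∨ y) ≤ ind x + ind y
  ind-∨ true  y = s≤s z≤n
  ind-∨ false y = ≤-refl

  -- a W counts words with no P in the positions 0, …, K
  1+W∸d : suc W ∸ d ≡ suc K
  1+W∸d = trans (cong (_∸ e) (sym (+-suc e K))) (m+n∸m≡n e (suc K))

  starts-with-P : sumWords σ W (λ x → ind (occ (stream x))) ≡ σ ^ K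
  starts-with-P = begin
    sumWords σ W (λ x → ind (occ (stream x)))
      ≡⟨ sumWords-window₀ (suc s) W d (λ u → ind (occ u)) ind-occ-dep (m≤m+n d K) ⟩
    σ ^ (W ∸ d) * sumWords σ d (λ y → ind (occ (stream y)))
      ≡⟨ cong₂ _*_ (cong (σ ^_) (m+n∸m≡n d K)) count-occ ⟩
    σ ^ K * 1
      ≡⟨ *-identityʳ (σ ^ K) ⟩
    σ ^ K ∎
    where open ≡-Reasoning

  card-hitting : card σ W hitting ≤ σ ^ K + a W
  card-hitting = begin
    card σ W hitting
      ≤⟨ sumWords-mono σ W (λ x → ind-∨ (occ (stream x)) (noOcc (stream x) (suc K))) ⟩
    sumWords σ W (λ x → ind (occ (stream x)) + ind (noOcc (stream x) (suc K)))
      ≡⟨ sumWords-+ σ W (λ x → ind (occ (stream x))) (λ x → ind (noOcc (stream x) (suc K))) ⟩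
    sumWords σ W (λ x → ind (occ (stream x))) + avoid (suc K) W
      ≡⟨ cong₂ _+_ starts-with-P (cong (λ c → avoid c W) (sym 1+W∸d)) ⟩
    σ ^ K + a W ∎
    where open ≤-Reasoning

  edge-shift : ∀ (x y : Word σ W) → Edge σ W x y → ∀ k → suc k < W → stream y k ≡ stream x (suc k)
  edge-shift x y (S , x≈S , y≈S) k 1+k<W = begin
    stream y k                        ≡⟨ stream-lookup< y k k<W ⟩
    y (fromℕ< k<W)                    ≡⟨ y≈S (fromℕ< k<W) ⟩
    S (fs (fromℕ< k<W))               ≡⟨ stream-lookup< (λ j → S (fs j)) k k<W ⟨
    stream S (suc k)                  ≡⟨ stream-init S (suc k) 1+k<W ⟨
    stream (λ j → S (inject₁ j)) (suc k) ≡⟨ stream-lookup< (λ j → S (inject₁ j)) (suc k) 1+k<W ⟩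
    S (inject₁ (fromℕ< 1+k<W))        ≡⟨ x≈S (fromℕ< 1+k<W) ⟨
    x (fromℕ< 1+k<W)                  ≡⟨ stream-lookup< x (suc k) 1+k<W ⟨
    stream x (suc k) ∎
    where
    open ≡-Reasoning
    k<W : k < W
    k<W = <-trans (n<1+n k) 1+k<W

  walk-shift : ∀ (v : ℕ → Word σ W) → IsWalk σ W W v →
    ∀ t k → t + k < W → stream (v t) k ≡ stream (v 0) (t + k)
  walk-shift v walk zero    k t+k<W = refl
  walk-shift v walk (suc t) k t+k<W = begin
    stream (v (suc t)) k   ≡⟨ edge-shift (v t) (v (suc t)) (walk t 1+t<W) k 1+k<W ⟩
    stream (v t) (suc k)   ≡⟨ walk-shift v walk t (suc k) (subst (_< W) (sym (+-suc t k)) t+k<W) ⟩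
    stream (v 0) (t + suc k) ≡⟨ cong (stream (v 0)) (+-suc t k) ⟩
    stream (v 0) (suc t + k) ∎
    where
    open ≡-Reasoning
    1+t<W : suc t < W
    1+t<W = ≤-<-trans (s≤s (m≤m+n t k)) t+k<W
    1+k<W : suc k < W
    1+k<W = ≤-<-trans (s≤s (m≤n+m k t)) t+k<W

  -- If v 0 contains P at a position j ≤ K, then v j begins with P; otherwise v 0 ∈ hitting.
  hits-walks : MeetsAllWalks σ W W hitting
  hits-walks v walk with noOcc (stream (v 0)) (suc K) in none
  ... | true = 0 , s≤s z≤n , trans (cong (occ (stream (v 0)) ∨_) none) (∨-zeroʳ (occ (stream (v 0))))
  ... | false with noOcc-false (stream (v 0)) (suc K) none
  ... | j , s≤s j≤K , oj = j , s≤s (≤-trans j≤K (m≤n+m K e)) ,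
    cong (_∨ noOcc (stream (v j)) (suc K))
      (trans (occ-dep (stream (v j)) (drop j (stream (v 0)))
                (λ k k<d → walk-shift v walk j k (<-≤-trans (+-monoʳ-< j k<d) j+d≤W))) oj)
    where
    j+d≤W : j + d ≤ W
    j+d≤W = ≤-trans (+-monoˡ-≤ d j≤K) (≤-reflexive (+-comm K d))

-- Charge every selected position q of a string of length m + W either to an
-- occurrence of P starting at q, or to the window i = q - K without P that selected it.  An occurrence
-- starts at a given position with probability σ^(-d), a window has no P with probability a(W)/σ^W.
module Density (s e K : ℕ) where

  open Pattern s e
  open Construction s e K

  toℕ-scheme-window : ∀ {m} (S : Word σ (m + W)) (i : Fin (suc m)) →
    toℕ (scheme (window S i)) ≡ first (drop (toℕ i) (stream S)) K
  toℕ-scheme-window S i =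
    trans (toℕ-scheme (window S i)) (first-dep K _ _ (λ k k< → window-stream S i k (<-trans k< K+e<W)))

  occ-drop-drop : ∀ (u : Stream σ) i j → occ (drop j (drop i u)) ≡ occ (drop (i + j) u)
  occ-drop-drop u i j = occ-dep _ _ (λ k _ → cong u (sym (+-assoc i j k)))

  module _ (m : ℕ) where

    occCharge : Stream σ → ℕ → ℕ
    occCharge u q = if ⌊ q ≤? m + K ⌋ then ind (occ (drop q u)) else 0

    emptyCharge : Stream σ → ℕ → ℕ
    emptyCharge u q = inRange K m (ind (noOcc (drop (q ∸ K) u) (suc K))) q

    charge : Stream σ → ℕ → ℕ
    charge u q = occCharge u q + emptyCharge u q

    charge-occ : ∀ u q → q ≤ m + K → occ (drop q u) ≡ true → 1 ≤ charge u q
    charge-occ u q q≤m+K o with q ≤? m + K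
    ... | yes _    rewrite o = s≤s z≤n
    ... | no  q≰m+K = ⊥-elim (q≰m+K q≤m+K)

    charge-empty : ∀ u i → i ≤ m → noOcc (drop i u) (suc K) ≡ true → 1 ≤ charge u (i + K)
    charge-empty u i i≤m none with K ≤? i + K
    ... | no  K≰i+K = ⊥-elim (K≰i+K (m≤n+m K i))
    ... | yes _ rewrite m+n∸n≡m i K with i ≤? m
    ...   | no  i≰m = ⊥-elim (i≰m i≤m)
    ...   | yes _   rewrite none = m≤n+m 1 (occCharge u (i + K))

    -- Every selected position carries a charge: the scheme picks in window i either an occurrence of P
    -- or, if the window has none, its position K.
    selected-charged : ∀ (S : Word σ (m + W)) (p : Fin (m + W)) →
      ind (selectedB {σ} {m} {W} scheme S p) ≤ charge (stream S) (toℕ p)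
    selected-charged S p with any? (λ i → toℕ i + toℕ (scheme (window {σ} {m} {W} S i)) ≟ toℕ p)
    ... | no  _         = z≤n
    ... | yes (i , i+f≡p) with first-spec (drop (toℕ i) (stream S)) K
    ...   | inj₁ (f≤K , o) = subst (λ q → 1 ≤ charge (stream S) q) i+f≡p′
              (charge-occ (stream S) _ (+-mono-≤ (≤-pred (toℕ<n i)) f≤K)
                          (trans (sym (occ-drop-drop (stream S) (toℕ i) _)) o))
      where
      i+f≡p′ : toℕ i + first (drop (toℕ i) (stream S)) K ≡ toℕ p
      i+f≡p′ = trans (cong (toℕ i +_) (sym (toℕ-scheme-window S i))) i+f≡p
    ...   | inj₂ (f≡K , none) = subst (λ q → 1 ≤ charge (stream S) q) i+K≡p
              (charge-empty (stream S) (toℕ i) (≤-pred (toℕ<n i)) none)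
      where
      i+K≡p : toℕ i + K ≡ toℕ p
      i+K≡p = trans (cong (toℕ i +_) (sym (trans (toℕ-scheme-window S i) f≡K))) i+f≡p

    total-occCharge : ∀ q → sumWords σ (m + W) (λ S → occCharge (stream S) q) ≤ σ ^ ((m + W) ∸ d)
    total-occCharge q with q ≤? m + K
    ... | no _ = ≤-trans (≤-reflexive (sumWords-zero σ (m + W))) z≤n
    ... | yes q≤m+K = ≤-reflexive (begin
      sumWords σ (m + W) (λ S → ind (occ (drop q (stream S))))
        ≡⟨ sumWords-window (suc s) (m + W) q d (λ u → ind (occ u)) ind-occ-dep q+d≤ ⟩
      σ ^ ((m + W) ∸ d) * sumWords σ d (λ y → ind (occ (stream y)))
        ≡⟨ cong (σ ^ ((m + W) ∸ d) *_) count-occ ⟩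
      σ ^ ((m + W) ∸ d) * 1
        ≡⟨ *-identityʳ _ ⟩
      σ ^ ((m + W) ∸ d) ∎)
      where
      open ≡-Reasoning
      q+d≤ : q + d ≤ m + W
      q+d≤ = ≤-trans (+-monoˡ-≤ d q≤m+K) (≤-reflexive (trans (+-assoc m K d) (cong (m +_) (+-comm K d))))

    total-emptyCharge : ∀ q → sumWords σ (m + W) (λ S → emptyCharge (stream S) q)
      ≡ inRange K m (σ ^ m * a W) q
    total-emptyCharge q with K ≤? q
    ... | no _ = sumWords-zero σ (m + W)
    ... | yes _ with q ∸ K ≤? m
    ...   | no _ = sumWords-zero σ (m + W)
    ...   | yes q∸K≤m = begin
      sumWords σ (m + W) (λ S → ind (noOcc (drop (q ∸ K) (stream S)) (suc K)))
        ≡⟨ sumWords-window (suc s) (m + W) (q ∸ K) W (λ u → ind (noOcc u (suc K))) noOcc-dep′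
                           (+-monoˡ-≤ W q∸K≤m) ⟩
      σ ^ ((m + W) ∸ W) * avoid (suc K) W
        ≡⟨ cong₂ (λ n c → σ ^ n * avoid c W) (m+n∸n≡m m W) (sym 1+W∸d) ⟩
      σ ^ m * a W ∎
      where
      open ≡-Reasoning
      noOcc-dep′ : DependsOn W (λ u → ind (noOcc u (suc K)))
      noOcc-dep′ u v u≈v =
        cong ind (DependsOn-weaken (≤-reflexive (cong suc (+-comm K e))) (noOcc-dep (suc K)) u v u≈v)

  totalSelected-bound : ∀ m →
    totalSelected σ W scheme m ≤ (m + W) * σ ^ ((m + W) ∸ d) + suc m * (σ ^ m * a W)
  totalSelected-bound m = begin
    totalSelected σ W scheme m
      ≤⟨ sumWords-mono σ n (λ S → sumFin-mono n (λ p → selected-charged m S p)) ⟩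
    sumWords σ n (λ S → sumFin n (λ p → occC S p + emptyC S p))
      ≡⟨ sumWords-cong σ n (λ S → sumFin-+ n (occC S) (emptyC S)) ⟩
    sumWords σ n (λ S → sumFin n (occC S) + sumFin n (emptyC S))
      ≡⟨ sumWords-+ σ n (λ S → sumFin n (occC S)) (λ S → sumFin n (emptyC S)) ⟩
    sumWords σ n (λ S → sumFin n (occC S)) + sumWords σ n (λ S → sumFin n (emptyC S))
      ≡⟨ cong₂ _+_ (sumWords-exchange σ n n occC) (sumWords-exchange σ n n emptyC) ⟩
    sumFin n (λ p → sumWords σ n (λ S → occC S p)) + sumFin n (λ p → sumWords σ n (λ S → emptyC S p))
      ≤⟨ +-mono-≤ (sumFin-mono n (λ p → total-occCharge m (toℕ p)))
                  (≤-reflexive (sumFin-cong n (λ p → total-emptyCharge m (toℕ p)))) ⟩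
    sumFin n (λ _ → σ ^ (n ∸ d)) + sumFin n (λ p → inRange K m (σ ^ m * a W) (toℕ p))
      ≤⟨ +-mono-≤ (≤-reflexive (sumFin-const n _)) (count-range K m (σ ^ m * a W) n) ⟩
    n * σ ^ (n ∸ d) + suc m * (σ ^ m * a W) ∎
    where
    open ≤-Reasoning
    n = m + W
    occC emptyC : Word σ n → Fin n → ℕ
    occC S p = occCharge m (stream S) (toℕ p)
    emptyC S p = emptyCharge m (stream S) (toℕ p)

Objects : ℕ → ℕ → ℕ → Set
Objects σ w c = (∃ λ (f : Scheme σ w) → Forward σ w f × DensityAtMost σ w f c w)
              × (∃ λ (U : Word σ w → Bool) → card σ w U * w ≤ c * σ ^ w × MeetsAllWalks σ w w U)

module Bounds (s e K : ℕ) where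

  open Pattern s e
  open Construction s e K
  open Density s e K

  σ^[n-d]*N : ∀ n → d ≤ n → σ ^ (n ∸ d) * N ≡ σ ^ n
  σ^[n-d]*N n d≤n = trans (sym (^-distribˡ-+-* σ (n ∸ d) d)) (cong (σ ^_) (m∸n+n≡m d≤n))

  module _ (c L : ℕ) (1≤L : 1 ≤ L) (W≤cLN : W ≤ c * L * N) (aW*W≤ : a W * W ≤ 2 * σ ^ W) where

    2*≤2L* : ∀ x → 2 * x ≤ 2 * L * x
    2*≤2L* x = *-monoˡ-≤ x (*-monoʳ-≤ 2 1≤L)

    occurrence-weight : ∀ n → d ≤ n → σ ^ (n ∸ d) * W ≤ c * L * σ ^ n
    occurrence-weight n d≤n = begin
      σ ^ (n ∸ d) * W             ≤⟨ *-monoʳ-≤ (σ ^ (n ∸ d)) W≤cLN ⟩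
      σ ^ (n ∸ d) * (c * L * N)   ≡⟨ *-left-comm (σ ^ (n ∸ d)) (c * L) N ⟩
      c * L * (σ ^ (n ∸ d) * N)   ≡⟨ cong (c * L *_) (σ^[n-d]*N n d≤n) ⟩
      c * L * σ ^ n               ∎
      where
      open ≤-Reasoning

    empty-window-weight : ∀ m → σ ^ m * (a W * W) ≤ 2 * L * σ ^ (m + W)
    empty-window-weight m = begin
      σ ^ m * (a W * W)       ≤⟨ *-monoʳ-≤ (σ ^ m) aW*W≤ ⟩
      σ ^ m * (2 * σ ^ W)     ≡⟨ *-left-comm (σ ^ m) 2 (σ ^ W) ⟩
      2 * (σ ^ m * σ ^ W)     ≡⟨ cong (2 *_) (^-distribˡ-+-* σ m W) ⟨
      2 * σ ^ (m + W)         ≤⟨ 2*≤2L* (σ ^ (m + W)) ⟩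
      2 * L * σ ^ (m + W)     ∎
      where
      open ≤-Reasoning

    hitting-density : card σ W hitting * W ≤ (2 + c) * L * σ ^ W
    hitting-density = begin
      card σ W hitting * W          ≤⟨ *-monoˡ-≤ W card-hitting ⟩
      (σ ^ K + a W) * W             ≡⟨ *-distribʳ-+ W (σ ^ K) (a W) ⟩
      σ ^ K * W + a W * W           ≤⟨ +-mono-≤ (subst (λ k → σ ^ k * W ≤ c * L * σ ^ W) (m+n∸m≡n d K)
                                                         (occurrence-weight W (m≤m+n d K)))
                                                  (≤-trans aW*W≤ (2*≤2L* (σ ^ W))) ⟩
      c * L * σ ^ W + 2 * L * σ ^ W ≡⟨ collect c L (σ ^ W) ⟩
      (2 + c) * L * σ ^ W           ∎
      where
      open ≤-Reasoning
      collect : ∀ c L Q → c * L * Q + 2 * L * Q ≡ (2 + c) * L * Q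
      collect = solve-∀

    -- For ε = 1/r, strings longer than c·L·r windows have selected fraction ≤ (c+2)L/W + 1/r.
    scheme-density : DensityAtMost σ W scheme ((2 + c) * L) W
    scheme-density r _ = c * L * r , eventually
      where
      eventually : ∀ m → c * L * r ≤ m →
        totalSelected σ W scheme m * W * r ≤ σ ^ (m + W) * suc m * ((2 + c) * L * r + W)
      eventually m cLr≤m = begin
        totalSelected σ W scheme m * W * r
          ≤⟨ *-monoˡ-≤ r (*-monoˡ-≤ W (totalSelected-bound m)) ⟩
        ((m + W) * σ ^ ((m + W) ∸ d) + suc m * (σ ^ m * a W)) * W * r
          ≡⟨ cong (_* r) (distribute (m + W) (σ ^ ((m + W) ∸ d)) (suc m) (σ ^ m) (a W) W) ⟩
        ((m + W) * (σ ^ ((m + W) ∸ d) * W) + suc m * (σ ^ m * (a W * W))) * r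
          ≤⟨ *-monoˡ-≤ r (+-mono-≤ (*-mono-≤ (+-monoˡ-≤ W (n≤1+n m)) (occurrence-weight (m + W) d≤m+W))
                                   (*-monoʳ-≤ (suc m) (empty-window-weight m))) ⟩
        ((suc m + W) * (c * L * Q) + suc m * (2 * L * Q)) * r
          ≡⟨ regroup m W c L Q r ⟩
        Q * (suc m * ((2 + c) * L * r) + W * (c * L * r))
          ≤⟨ *-monoʳ-≤ Q (+-monoʳ-≤ (suc m * ((2 + c) * L * r))
                                     (*-monoʳ-≤ W (≤-trans cLr≤m (n≤1+n m)))) ⟩
        Q * (suc m * ((2 + c) * L * r) + W * suc m)
          ≡⟨ factor Q m ((2 + c) * L * r) W ⟩
        Q * suc m * ((2 + c) * L * r + W) ∎
        where
        open ≤-Reasoning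
        Q = σ ^ (m + W)
        d≤m+W : d ≤ m + W
        d≤m+W = ≤-trans (m≤m+n d K) (m≤n+m W m)
        distribute : ∀ n G k x y w → (n * G + k * (x * y)) * w ≡ n * (G * w) + k * (x * (y * w))
        distribute = solve-∀
        regroup : ∀ m W c L Q r →
          ((suc m + W) * (c * L * Q) + suc m * (2 * L * Q)) * r ≡ Q * (suc m * ((2 + c) * L * r) + W * (c * L * r))
        regroup = solve-∀
        factor : ∀ Q m x W → Q * (suc m * x + W * suc m) ≡ Q * suc m * (x + W)
        factor = solve-∀

    objects : Objects σ W ((2 + c) * L)
    objects = (scheme , forward , scheme-density) , (hitting , hitting-density , hits-walks)

-- Choice of parameters for a given w: with L = ⌊log₂ w⌋, take d maximal with d + L·σ^d ≤ w
-- and K = w - d.  Maximality gives w ≤ (σ + 1)·L·σ^d, and d + L·σ^d ≤ w gives a(w) ≤ 2^(-L)·σ^w.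
module Choice (s w : ℕ) where

  σ : ℕ
  σ = suc (suc s)

  L : ℕ
  L = ⌊log₂ w ⌋

  Fits : ℕ → Set
  Fits d = d + L * σ ^ d ≤ w

  module _ (large : 2 ^ (σ + σ * σ) ≤ w) where

    σ+σ²≤L : σ + σ * σ ≤ L
    σ+σ²≤L = subst (_≤ L) (⌊log₂[2^n]⌋≡n (σ + σ * σ)) (⌊log₂⌋-mono-≤ large)

    1≤L : 1 ≤ L
    1≤L = ≤-trans (s≤s z≤n) σ+σ²≤L

    fits-1 : Fits 1
    fits-1 = begin
      1 + L * (σ * 1)   ≡⟨ cong (λ x → 1 + L * x) (*-identityʳ σ) ⟩
      suc (L * σ)       ≤⟨ σL<2^L σ L σ+σ²≤L ⟩
      2 ^ L             ≤⟨ 2^⌊log₂⌋≤n w (≤-trans (m^n>0 2 (σ + σ * σ)) large) ⟩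
      w                 ∎
      where open ≤-Reasoning

    ¬fits-1+w : ¬ Fits (suc w)
    ¬fits-1+w fits = 1+n≰n (≤-trans (m≤m+n (suc w) _) fits)

    module _ (e : ℕ) (fits : Fits (suc e)) (¬fits : ¬ Fits (suc (suc e))) where

      open Pattern s e using (N; a; a-bound)

      K : ℕ
      K = w ∸ suc e

      W≡w : suc e + K ≡ w
      W≡w = m+[n∸m]≡n (≤-trans (m≤m+n (suc e) _) fits)

      -- maximality of d bounds w by the occurrence probability σ^(-d)
      w≤[σ+1]LN : w ≤ suc σ * L * N
      w≤[σ+1]LN = begin
        w                           ≤⟨ ≤-pred (≰⇒> ¬fits) ⟩
        suc e + L * (σ * N)         ≤⟨ +-monoˡ-≤ (L * (σ * N)) (≤-trans d≤N N≤LN) ⟩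
        L * N + L * (σ * N)         ≡⟨ collect σ L N ⟩
        suc σ * L * N               ∎
        where
        open ≤-Reasoning
        d≤N : suc e ≤ N
        d≤N = ≤-trans (<⇒≤ (n<2^n (suc e))) (^-monoˡ-≤ (suc e) (s≤s (s≤s z≤n)))
        N≤LN : N ≤ L * N
        N≤LN = ≤-trans (≤-reflexive (sym (*-identityˡ N))) (*-monoˡ-≤ N 1≤L)
        collect : ∀ σ L N → L * N + L * (σ * N) ≡ suc σ * L * N
        collect = solve-∀

      -- and d + L·σ^d ≤ w makes the P-free words a fraction ≤ 2^(-L) < 2/w.
      aw*w≤ : a w * w ≤ 2 * σ ^ w
      aw*w≤ = begin
        a w * w             ≤⟨ *-monoʳ-≤ (a w) (<⇒≤ (n<2^[1+⌊log₂⌋] w)) ⟩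
        a w * (2 * 2 ^ L)   ≡⟨ *-left-comm (a w) 2 (2 ^ L) ⟩
        2 * (a w * 2 ^ L)   ≤⟨ *-monoʳ-≤ 2 (a-bound L w (≤-trans (n≤1+n _) fits)) ⟩
        2 * σ ^ w           ∎
        where
        open ≤-Reasoning

      objects-d : Objects σ w ((2 + suc σ) * L)
      objects-d = subst (λ W → Objects σ W ((2 + suc σ) * L)) W≡w
        (Bounds.objects s e K (suc σ) L 1≤L
          (subst (_≤ suc σ * L * N) (sym W≡w) w≤[σ+1]LN)
          (subst (λ W → a W * W ≤ 2 * σ ^ W) (sym W≡w) aw*w≤))

    objects : Objects σ w ((2 + suc σ) * L)
    objects with last-true Fits (λ d → d + L * σ ^ d ≤? w) fits-1 w ¬fits-1+w
    ... | suc e , _ , fits , ¬fits = objects-d e fits ¬fits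

theorem2 : (σ : ℕ) → 2 ≤ σ →
    ∃ λ C → 0 < C × ∃ λ w₀ → (w : ℕ) → w₀ ≤ w →
      (∃ λ (f : Scheme σ w) → Forward σ w f × DensityAtMost σ w f (C * ⌊log₂ w ⌋) w)
      × (∃ λ (U : Word σ w → Bool) → card σ w U * w ≤ C * ⌊log₂ w ⌋ * σ ^ w × MeetsAllWalks σ w w U)
theorem2 (suc (suc s)) (s≤s (s≤s z≤n)) =
  2 + suc σ , s≤s z≤n , 2 ^ (σ + σ * σ) , λ w large → Choice.objects s w large
  where
  σ : ℕ
  σ = suc (suc s)
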